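{- The equation \[ N_n = a\left(\frac{100^\ell-1}{100-1}\right) \] has no solutions in non-negative integers $n$ and integers $\ell\ge 2$, $a\in\{1,\dots,99\}$. Equivalently, no Narayana number is a base-$100$ repdigit with at least two digits (i.e., no Narayana number consists of at least two repetitions of the same decimal $2$-block).
   Context: The Narayana sequence $(N_n)_{n\ge0}$ is defined by $N_0=0$, $N_1=N_2=1$ and $N_n=N_{n-1}+N_{n-3}$ for $n\ge 3$. -}

module Defs where

open import Data.Nat using (ℕ; zero; suc; _+_)

N : ℕ → ℕ
N 0 = 0
N 1 = 1
N 2 = 1
N (suc (suc (suc n))) = N (suc (suc n)) + N n

-- For ℓ = 2 the equation reads N n = 101 a ≤ 9999; since N 27 = 12664 this leaves
-- finitely many n, none of which gives a positive multiple of 101.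
-- For ℓ ≥ 3 we sieve modulo M = 2⁶·3·5²·13·29·31·61·127. The residue N n mod M has
-- period P = 312480 in n, and the repunit R ℓ = (100^ℓ − 1)/99 has period 210 mod M
-- for ℓ ≥ 3, because M ∣ 100³ R 210. Moreover R ℓ ≡ 501 (mod 1600) for ℓ ≥ 3 and
-- 501·1501 ≡ 1 (mod 1600), so N n ≡ a R ℓ (mod M) forces a ≡ 1501 N n (mod 1600),
-- which determines the digit a from N n mod M. A finite computation over one period
-- of N then checks that this a is never a solution for any of the 210 residues of R ℓ.
module Submission where

open import Defs
open import Data.Nat using (ℕ; _≤_; _*_; _∸_; _^_; _/_)
open import Relation.Binary.PropositionalEquality using (_≡_)
open import Relation.Nullary using (¬_)

open import Level using (Level)
open import Data.Bool using (Bool; true; T; not; _∧_; _∨_)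
open import Data.Bool.Properties using (T-∧; T-∨)
open import Data.Bool.ListAction using (all; any)
open import Data.List using (List; []; _∷_; upTo)
import Data.List as List
open import Data.List.Membership.Propositional.Properties using (∈-upTo⁺)
open import Data.List.Relation.Unary.All as All using (All)
open import Data.List.Relation.Unary.All.Properties using (all⁺)
open import Data.List.Relation.Unary.Any as Any using (Any)
open import Data.List.Relation.Unary.Any.Properties using (any⁻)
open import Data.Nat using (zero; suc; _+_; _%_; _<_; _≤′_; ≤′-reflexive; ≤′-step; NonZero; _≡ᵇ_; _<ᵇ_; z≤n; s≤s; _<?_)
open import Data.Nat.DivMod
open import Data.Nat.Divisibility using (_∣_; m%n≡0⇒n∣m; ∣m⇒∣m*n; ∣n⇒∣m*n)
open import Data.Nat.GeneralisedArithmetic using (fold; iterate; fold-+; iterate-is-fold)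
open import Data.Nat.Properties
open import Data.Nat.Tactic.RingSolver using (solve-∀)
open import Data.Product using (_×_; _,_; proj₁; ∃-syntax)
open import Data.Sum using (inj₁; inj₂)
open import Function using (_∘_)
open import Function.Bundles using (Equivalence)
open import Relation.Binary.PropositionalEquality using (_≢_; refl; sym; trans; cong; subst; module ≡-Reasoning)
open import Relation.Nullary using (yes; no)

open ≡-Reasoning

private
  variable
    ℓ′ : Level
    A : Set ℓ′

≢ᵇ⇒≢ : ∀ m n → T (not (m ≡ᵇ n)) → m ≢ n
≢ᵇ⇒≢ m n m≢ᵇn m≡n with m ≡ᵇ n | ≡⇒≡ᵇ m n m≡n
... | true  | _ = m≢ᵇn

lookup-iterate : ∀ {Q : A → Set} f x k → All Q (List.iterate f x k) →
                 ∀ {i} → i < k → Q (iterate f x i)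
lookup-iterate f x (suc k) (px All.∷ _)   {zero}  _          = px
lookup-iterate f x (suc k) (_  All.∷ pxs) {suc i} (s≤s i<k) = lookup-iterate f (f x) k pxs i<k

all∧any⇒∃ : ∀ (p q : A → Bool) xs → T (all p xs) → T (any q xs) → ∃[ y ] T (p y) × T (q y)
all∧any⇒∃ p q xs ps qs = Any.lookup q∈ , All.lookupAny (all⁺ p xs ps) q∈
  where
  q∈ : Any (T ∘ q) xs
  q∈ = any⁻ q xs qs

periodic⇒≡% : (g : ℕ → A) (p : ℕ) .{{_ : NonZero p}} →
              (∀ x → g (x + p) ≡ g x) → ∀ x → g x ≡ g (x % p)
periodic⇒≡% g p shift x = begin
  g x                   ≡⟨ cong g (m≡m%n+[m/n]*n x p) ⟩
  g (x % p + x / p * p) ≡⟨ repeat (x % p) (x / p) ⟩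
  g (x % p)             ∎
  where
  repeat : ∀ r q → g (r + q * p) ≡ g r
  repeat r zero    = cong g (+-identityʳ r)
  repeat r (suc q) = begin
    g (r + (p + q * p)) ≡⟨ cong (λ k → g (r + k)) (+-comm p (q * p)) ⟩
    g (r + (q * p + p)) ≡⟨ cong g (sym (+-assoc r (q * p) p)) ⟩
    g (r + q * p + p)   ≡⟨ shift (r + q * p) ⟩
    g (r + q * p)       ≡⟨ repeat r q ⟩
    g r                 ∎

*-%-absorbʳ : ∀ m n d .{{_ : NonZero d}} → (m * (n % d)) % d ≡ (m * n) % d
*-%-absorbʳ m n d = begin
  (m * (n % d)) % d           ≡⟨ %-distribˡ-* m (n % d) d ⟩
  (m % d * (n % d % d)) % d   ≡⟨ cong (λ k → (m % d * k) % d) (m%n%n≡m%n n d) ⟩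
  (m % d * (n % d)) % d       ≡⟨ %-distribˡ-* m n d ⟨
  (m * n) % d                 ∎

%-cancel-inverse : ∀ a x y d .{{_ : NonZero d}} → (x * y) % d ≡ 1 →
                   ((a * x) % d * y) % d ≡ a % d
%-cancel-inverse a x y d xy≡1 = begin
  ((a * x) % d * y) % d   ≡⟨ cong (_% d) (*-comm ((a * x) % d) y) ⟩
  (y * ((a * x) % d)) % d ≡⟨ *-%-absorbʳ y (a * x) d ⟩
  (y * (a * x)) % d       ≡⟨ cong (_% d) (ring y a x) ⟩
  (a * (x * y)) % d       ≡⟨ *-%-absorbʳ a (x * y) d ⟨
  (a * ((x * y) % d)) % d ≡⟨ cong (λ k → (a * k) % d) xy≡1 ⟩
  (a * 1) % d             ≡⟨ cong (_% d) (*-identityʳ a) ⟩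
  a % d                   ∎
  where
  ring : ∀ y a x → y * (a * x) ≡ a * (x * y)
  ring = solve-∀

Window : Set
Window = ℕ × ℕ × ℕ

step : (m : ℕ) .{{_ : NonZero m}} → Window → Window
step m (x , y , z) = y , z , (z + x) % m

window : (m : ℕ) .{{_ : NonZero m}} → ℕ → Window
window m n = N n % m , N (suc n) % m , N (suc (suc n)) % m

fold-step≡window : ∀ m .{{_ : NonZero m}} n → fold (window m 0) (step m) n ≡ window m n
fold-step≡window m zero    = refl
fold-step≡window m (suc n) = begin
  step m (fold (window m 0) (step m) n) ≡⟨ cong (step m) (fold-step≡window m n) ⟩
  step m (window m n)
    ≡⟨ cong (λ k → N (suc n) % m , N (suc (suc n)) % m , k) (%-distribˡ-+ (N (suc (suc n))) (N n) m) ⟨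
  window m (suc n)                      ∎

iterate-step≡window : ∀ m .{{_ : NonZero m}} n → iterate (step m) (window m 0) n ≡ window m n
iterate-step≡window m n = trans (sym (iterate-is-fold (window m 0) (step m) n)) (fold-step≡window m n)

N-%-periodic : ∀ m .{{_ : NonZero m}} p .{{_ : NonZero p}} →
               iterate (step m) (window m 0) p ≡ window m 0 →
               ∀ n → N n % m ≡ N (n % p) % m
N-%-periodic m p period n = cong proj₁ (periodic⇒≡% (window m) p shift n)
  where
  w₀ : Window
  w₀ = window m 0
  shift : ∀ n → window m (n + p) ≡ window m n
  shift n = begin
    window m (n + p)                 ≡⟨ fold-step≡window m (n + p) ⟨
    fold w₀ (step m) (n + p)         ≡⟨ fold-+ w₀ (step m) n ⟩
    fold (fold w₀ (step m) p) (step m) n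
      ≡⟨ cong (λ w → fold w (step m) n) (trans (iterate-is-fold w₀ (step m) p) period) ⟩
    fold w₀ (step m) n               ≡⟨ fold-step≡window m n ⟩
    window m n                       ∎

repunit : ℕ → ℕ → ℕ
repunit b zero    = 0
repunit b (suc l) = 1 + b * repunit b l

repunit-+ : ∀ b l j → repunit b (l + j) ≡ repunit b l + b ^ l * repunit b j
repunit-+ b zero    j = sym (+-identityʳ (repunit b j))
repunit-+ b (suc l) j = begin
  1 + b * repunit b (l + j)                          ≡⟨ cong (λ k → 1 + b * k) (repunit-+ b l j) ⟩
  1 + b * (repunit b l + b ^ l * repunit b j)        ≡⟨ ring b (repunit b l) (b ^ l) (repunit b j) ⟩
  1 + b * repunit b l + b * b ^ l * repunit b j      ∎
  where
  ring : ∀ b r q s → 1 + b * (r + q * s) ≡ 1 + b * r + b * q * s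
  ring = solve-∀

^≡repunit : ∀ c l → suc c ^ l ≡ repunit (suc c) l * c + 1
^≡repunit c zero    = refl
^≡repunit c (suc l) = begin
  suc c * suc c ^ l                       ≡⟨ cong (suc c *_) (^≡repunit c l) ⟩
  suc c * (repunit (suc c) l * c + 1)     ≡⟨ ring c (repunit (suc c) l) ⟩
  (1 + suc c * repunit (suc c) l) * c + 1 ∎
  where
  ring : ∀ c r → suc c * (r * c + 1) ≡ (1 + suc c * r) * c + 1
  ring = solve-∀

[^∸1]/≡repunit : ∀ c .{{_ : NonZero c}} l → (suc c ^ l ∸ 1) / c ≡ repunit (suc c) l
[^∸1]/≡repunit c l = begin
  (suc c ^ l ∸ 1) / c                   ≡⟨ cong (λ k → (k ∸ 1) / c) (^≡repunit c l) ⟩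
  (repunit (suc c) l * c + 1 ∸ 1) / c   ≡⟨ cong (_/ c) (m+n∸n≡m (repunit (suc c) l * c) 1) ⟩
  repunit (suc c) l * c / c             ≡⟨ m*n/n≡m (repunit (suc c) l) c ⟩
  repunit (suc c) l                     ∎

repunit-%-periodic : ∀ b s p d .{{_ : NonZero p}} .{{_ : NonZero d}} →
                     d ∣ b ^ s * repunit b p →
                     ∀ t → repunit b (s + t) % d ≡ repunit b (s + t % p) % d
repunit-%-periodic b s p d d∣ = periodic⇒≡% (λ u → repunit b (s + u) % d) p shift
  where
  tail-divisible : ∀ u → d ∣ b ^ (s + u) * repunit b p
  tail-divisible u = subst (d ∣_) rearrange (∣n⇒∣m*n (b ^ u) d∣)
    where
    rearrange : b ^ u * (b ^ s * repunit b p) ≡ b ^ (s + u) * repunit b p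
    rearrange = begin
      b ^ u * (b ^ s * repunit b p) ≡⟨ ring (b ^ u) (b ^ s) (repunit b p) ⟩
      b ^ s * b ^ u * repunit b p   ≡⟨ cong (_* repunit b p) (^-distribˡ-+-* b s u) ⟨
      b ^ (s + u) * repunit b p     ∎
      where
      ring : ∀ x y z → x * (y * z) ≡ y * x * z
      ring = solve-∀
  shift : ∀ u → repunit b (s + (u + p)) % d ≡ repunit b (s + u) % d
  shift u = begin
    repunit b (s + (u + p)) % d                          ≡⟨ cong (λ k → repunit b k % d) (+-assoc s u p) ⟨
    repunit b (s + u + p) % d                            ≡⟨ cong (_% d) (repunit-+ b (s + u) p) ⟩
    (repunit b (s + u) + b ^ (s + u) * repunit b p) % d  ≡⟨ %-remove-+ʳ _ (tail-divisible u) ⟩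
    repunit b (s + u) % d                                ∎

N-≤-suc : ∀ n → N n ≤ N (suc n)
N-≤-suc 0                   = z≤n
N-≤-suc 1                   = ≤-refl
N-≤-suc 2                   = s≤s z≤n
N-≤-suc (suc (suc (suc n))) = m≤m+n (N (suc (suc (suc n)))) (N (suc n))

N-mono-≤ : ∀ {m n} → m ≤ n → N m ≤ N n
N-mono-≤ m≤n = mono′ (≤⇒≤′ m≤n)
  where
  mono′ : ∀ {m n} → m ≤′ n → N m ≤ N n
  mono′ (≤′-reflexive refl)        = ≤-refl
  mono′ {n = suc n} (≤′-step m≤′n) = ≤-trans (mono′ m≤′n) (N-≤-suc n)

zeroOrNotMultipleOf101 : ℕ → Bool
zeroOrNotMultipleOf101 x = (x ≡ᵇ 0) ∨ not (x % 101 ≡ᵇ 0)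

noMultipleOf101Below27 : T (all (zeroOrNotMultipleOf101 ∘ N) (upTo 27))
noMultipleOf101Below27 = _

N≢101* : ∀ n a → 1 ≤ a → a ≤ 99 → N n ≢ a * 101
N≢101* n a@(suc _) _ a≤99 N≡ with n <? 27
... | yes n<27 with Equivalence.to T-∨ (All.lookup (all⁺ (zeroOrNotMultipleOf101 ∘ N) (upTo 27) noMultipleOf101Below27)
                                                   (∈-upTo⁺ n<27))
...   | inj₁ N≡ᵇ0 with trans (sym (≡ᵇ⇒≡ (N n) 0 N≡ᵇ0)) N≡
...     | ()
N≢101* n a _ a≤99 N≡ | yes n<27 | inj₂ 101∤N =
  ≢ᵇ⇒≢ (N n % 101) 0 101∤N (trans (cong (_% 101) N≡) (m*n%n≡0 a 101))
N≢101* n a _ a≤99 N≡ | no n≮27 = <⇒≱ (<ᵇ⇒< 9999 (N 27) _) N27≤9999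
  where
  N27≤9999 : N 27 ≤ 9999
  N27≤9999 = ≤-trans (N-mono-≤ (≮⇒≥ n≮27)) (subst (_≤ 9999) (sym N≡) (*-monoˡ-≤ 101 a≤99))

M : ℕ
M = 434588107200

P : ℕ
P = 312480

Group : Set
Group = ℕ × List ℕ

-- The 210 residues repunit 100 ℓ % M for 3 ≤ ℓ < 213, grouped by their residue k mod 39,
-- so that for a given a and v most groups are discarded by comparing a * k with v mod 39.
residueTable : List Group
residueTable =
  (0 , (10101 ∷ 10101010101 ∷ 313313467701 ∷ 213931920501 ∷ 275086416501 ∷ 401817446901 ∷ 325100640501 ∷ 53500334901 ∷ 365964154101 ∷ 116556533301 ∷ 2949970101 ∷ 420617443701 ∷ 40383168501 ∷ 372403771701 ∷ 7584043701 ∷ 46642262901 ∷ 94295770101 ∷ 146365075701 ∷ 147077122101 ∷ 338157528501 ∷ 176407618101 ∷ 48214493301 ∷ 419512027701 ∷ 216527885301 ∷ 10534003701 ∷ 22570589301 ∷ 255953578101 ∷ 304836926901 ∷ 314162856501 ∷ 417570451701 ∷ 380190854901 ∷ 141079234101 ∷ 200624995701 ∷ 3540773301 ∷ 183991651701 ∷ 84755746101 ∷ 200494330101 ∷ 148961040501 ∷ 317112816501 ∷ 393498778101 ∷ 107260555701 ∷ 299551085301 ∷ 367710730101 ∷ 82953696501 ∷ 387774888501 ∷ 177620486901 ∷ 416195405301 ∷ 370562035701 ∷ 55982357301 ∷ 21095827701 ∷ 51801307701 ∷ 143675198901 ∷ 370660690101 ∷ 58882022901 ∷ 114844589301 ∷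 336092338101 ∷ 148693032501 ∷ 15386851701 ∷ 259765594101 ∷ 113960568501 ∷ 267502382901 ∷ 365276194101 ∷ 109530230901 ∷ 121067179701 ∷ 59385341301 ∷ 180216451701 ∷ 151642992501 ∷ 425903285301 ∷ 421423402101 ∷ 272432419701 ∷ [])) ∷
  (1 , (1010101 ∷ 140924795701 ∷ 41003051701 ∷ 98374797301 ∷ 129590896501 ∷ 199638827701 ∷ 350544117301 ∷ 134976203701 ∷ 91014405301 ∷ 356362542901 ∷ 294997010101 ∷ 341286078901 ∷ 127023885301 ∷ 300388058101 ∷ 323816262901 ∷ 318345218101 ∷ 303226758901 ∷ 295100032501 ∷ 366304672501 ∷ 352468595701 ∷ 257237522101 ∷ 40980150901 ∷ 230744478901 ∷ 357971277301 ∷ 184224155701 ∷ 84118394101 ∷ 389247592501 ∷ 62525186101 ∷ 125941931701 ∷ 36586878901 ∷ 209920163701 ∷ 201103979701 ∷ 71446638901 ∷ 354077330101 ∷ 146464667701 ∷ 218400573301 ∷ 58380078901 ∷ 120108405301 ∷ 420937931701 ∷ 236948162101 ∷ 295940997301 ∷ 403117240501 ∷ 265672005301 ∷ 38195613301 ∷ 99147309301 ∷ 378524402101 ∷ 333670346101 ∷ 116214458101 ∷ 383178443701 ∷ 371230341301 ∷ 399661590901 ∷ 26112352501 ∷ 126079898101 ∷ 238556896501 ∷ 185168142901 ∷ 145949555701 ∷ 93307605301 ∷ 234920848501 ∷ 335861085301 ∷ 96766062901 ∷ 240363750901 ∷ 22218405301 ∷ 88320410101 ∷ 372839075701 ∷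 288888736501 ∷ 203532774901 ∷ 388303605301 ∷ 694024501 ∷ 421881918901 ∷ 298779323701 ∷ [])) ∷
  (23 , (101010101 ∷ 185660139701 ∷ 189012205301 ∷ 276541371701 ∷ 356034541301 ∷ 407417946101 ∷ 287363154101 ∷ 25389046901 ∷ 409678386101 ∷ 29499701 ∷ 382297827701 ∷ 230735528501 ∷ 99333421301 ∷ 52226413301 ∷ 222106357301 ∷ 109589984501 ∷ 336096493301 ∷ 392600067701 ∷ 125066245301 ∷ 45222886901 ∷ 83053885301 ∷ 186722125301 ∷ 41278208501 ∷ 160902939701 ∷ 169715067701 ∷ 154665373301 ∷ 246417709301 ∷ 168285109301 ∷ 425726168501 ∷ 181983032501 ∷ 131787224501 ∷ 119345038901 ∷ 191254174901 ∷ 206096326901 ∷ 305059232501 ∷ 110651970101 ∷ 188362496501 ∷ 276961635701 ∷ 373334878901 ∷ 227058421301 ∷ 42108440501 ∷ 329618187701 ∷ 57325990901 ∷ 342856472501 ∷ 353792571701 ∷ 43274883701 ∷ 338338462901 ∷ 322155022901 ∷ 74090936501 ∷ 183045018101 ∷ 418641334901 ∷ 3706606901 ∷ 4934701301 ∷ 387931861301 ∷ 264113787701 ∷ 253548032501 ∷ 204410278901 ∷ 24327061301 ∷ 122824275701 ∷ 115667931701 ∷ 134029194101 ∷ 48899994101 ∷ 140278866101 ∷ 343918458101 ∷ 206058574901 ∷ 362224558901 ∷ 152018989301 ∷ 69402450101 ∷ 33145491701 ∷ 325941080501 ∷ [])) ∷ []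

groupContains : ℕ → Group → Bool
groupContains x (k , xs) = (x % 39 ≡ᵇ k) ∧ any (x ≡ᵇ_) xs

inResidueTable : ℕ → Bool
inResidueTable x = any (groupContains x) residueTable

groupAvoids : ℕ → ℕ → Group → Bool
groupAvoids a v (k , xs) = not ((a * k) % 39 ≡ᵇ v % 39) ∨ all (λ x → not ((a * x) % M ≡ᵇ v)) xs

digitRejected : ℕ → ℕ → Bool
digitRejected a v = (a ≡ᵇ 0) ∨ (99 <ᵇ a) ∨ all (groupAvoids a v) residueTable

candidate : ℕ → ℕ
candidate v = (v % 1600 * 1501) % 1600

sieve : ℕ → Bool
sieve v = digitRejected (candidate v) v

1600∣M : 1600 ∣ M
1600∣M = m%n≡0⇒n∣m M 1600 refl

39∣M : 39 ∣ M
39∣M = m%n≡0⇒n∣m M 39 refl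

%-≡-weaken : ∀ d .{{_ : NonZero d}} x {v} → d ∣ M → x % M ≡ v → x % d ≡ v % d
%-≡-weaken d x d∣M x≡v = trans (sym (m∣n⇒o%n%m≡o%m d M x d∣M)) (cong (_% d) x≡v)

repunit≥3-%1600 : ∀ t → repunit 100 (3 + t) % 1600 ≡ 501
repunit≥3-%1600 t = begin
  repunit 100 (3 + t) % 1600                       ≡⟨ cong (_% 1600) (repunit-+ 100 3 t) ⟩
  (repunit 100 3 + 100 ^ 3 * repunit 100 t) % 1600 ≡⟨ %-remove-+ʳ (repunit 100 3) 1600∣tail ⟩
  repunit 100 3 % 1600                             ≡⟨⟩
  501                                              ∎
  where
  1600∣tail : 1600 ∣ 100 ^ 3 * repunit 100 t
  1600∣tail = ∣m⇒∣m*n (repunit 100 t) (m%n≡0⇒n∣m (100 ^ 3) 1600 refl)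

candidate-correct : ∀ {a x v} → a < 1600 → x % 1600 ≡ 501 → (a * x) % M ≡ v → candidate v ≡ a
candidate-correct {a} {x} {v} a<1600 x≡501 ax≡v = begin
  (v % 1600 * 1501) % 1600                 ≡⟨ cong (λ k → (k * 1501) % 1600) v≡a*501 ⟨
  ((a * 501) % 1600 * 1501) % 1600         ≡⟨ %-cancel-inverse a 501 1501 1600 refl ⟩
  a % 1600                                 ≡⟨ m<n⇒m%n≡m a<1600 ⟩
  a                                        ∎
  where
  v≡a*501 : (a * 501) % 1600 ≡ v % 1600
  v≡a*501 = begin
    (a * 501) % 1600          ≡⟨ cong (λ k → (a * k) % 1600) x≡501 ⟨
    (a * (x % 1600)) % 1600   ≡⟨ *-%-absorbʳ a x 1600 ⟩
    (a * x) % 1600            ≡⟨ %-≡-weaken 1600 (a * x) 1600∣M ax≡v ⟩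
    v % 1600                  ∎

groupAvoids-sound : ∀ {a v x} g → T (groupAvoids a v g) → T (groupContains x g) → (a * x) % M ≢ v
groupAvoids-sound {a} {v} {x} (k , xs) avoids contains ax≡v
  with Equivalence.to (T-∧ {x % 39 ≡ᵇ k}) contains
... | x%39≡ᵇk , x∈xs with Equivalence.to (T-∨ {not ((a * k) % 39 ≡ᵇ v % 39)}) avoids
...   | inj₁ k-rejected = ≢ᵇ⇒≢ _ _ k-rejected (begin
  (a * k) % 39        ≡⟨ cong (λ k → (a * k) % 39) (≡ᵇ⇒≡ _ _ x%39≡ᵇk) ⟨
  (a * (x % 39)) % 39 ≡⟨ *-%-absorbʳ a x 39 ⟩
  (a * x) % 39        ≡⟨ %-≡-weaken 39 (a * x) 39∣M ax≡v ⟩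
  v % 39              ∎)
...   | inj₂ xs-rejected with all∧any⇒∃ (λ y → not ((a * y) % M ≡ᵇ v)) (x ≡ᵇ_) xs xs-rejected x∈xs
...     | y , y-rejected , x≡ᵇy = ≢ᵇ⇒≢ _ _ y-rejected (subst (λ y → (a * y) % M ≡ v) (≡ᵇ⇒≡ x y x≡ᵇy) ax≡v)

digitRejected-sound : ∀ {a v x} → T (digitRejected a v) → T (inResidueTable x) →
                      1 ≤ a → a ≤ 99 → (a * x) % M ≢ v
digitRejected-sound {a} {v} {x} rejected contains 1≤a a≤99 ax≡v
  with Equivalence.to (T-∨ {a ≡ᵇ 0}) rejected
... | inj₁ a≡ᵇ0 = <⇒≢ 1≤a (sym (≡ᵇ⇒≡ a 0 a≡ᵇ0))
... | inj₂ rest with Equivalence.to (T-∨ {99 <ᵇ a}) rest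
...   | inj₁ 99<ᵇa = <⇒≱ (<ᵇ⇒< 99 a 99<ᵇa) a≤99
...   | inj₂ avoids with all∧any⇒∃ (groupAvoids a v) (groupContains x) residueTable avoids contains
...     | g , g-avoids , g-contains = groupAvoids-sound {a} {v} {x} g g-avoids g-contains ax≡v

sieve-sound : ∀ {a v x} → T (sieve v) → T (inResidueTable x) →
              x % 1600 ≡ 501 → 1 ≤ a → a ≤ 99 → (a * x) % M ≢ v
sieve-sound {a} {v} sieved contains x≡501 1≤a a≤99 ax≡v =
  digitRejected-sound (subst (λ c → T (digitRejected c v)) a≡candidate sieved) contains 1≤a a≤99 ax≡v
  where
  a≡candidate : candidate v ≡ a
  a≡candidate = candidate-correct (≤-<-trans a≤99 (<ᵇ⇒< 99 1600 _)) x≡501 ax≡v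

M∣100³*repunit210 : M ∣ 100 ^ 3 * repunit 100 210
M∣100³*repunit210 = m%n≡0⇒n∣m _ M refl

residueTable-complete : T (all (λ i → inResidueTable (repunit 100 (3 + i) % M)) (upTo 210))
residueTable-complete = _

N-period : iterate (step M) (window M 0) P ≡ window M 0
N-period = refl

sieve-orbit : T (all (sieve ∘ proj₁) (List.iterate (step M) (window M 0) P))
sieve-orbit = _

sieve-N : ∀ n → T (sieve (N n % M))
sieve-N n = subst (T ∘ sieve) N%M≡
  (lookup-iterate {Q = T ∘ sieve ∘ proj₁} (step M) (window M 0) P orbit (m%n<n n P))
  where
  orbit : All (T ∘ sieve ∘ proj₁) (List.iterate (step M) (window M 0) P)
  orbit = all⁺ (sieve ∘ proj₁) (List.iterate (step M) (window M 0) P) sieve-orbit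
  N%M≡ : proj₁ (iterate (step M) (window M 0) (n % P)) ≡ N n % M
  N%M≡ = trans (cong proj₁ (iterate-step≡window M (n % P))) (sym (N-%-periodic M P N-period n))

N≢*repunit≥3 : ∀ n t a → 1 ≤ a → a ≤ 99 → N n ≢ a * repunit 100 (3 + t)
N≢*repunit≥3 n t a 1≤a a≤99 N≡ = sieve-sound (sieve-N n) x∈table x≡501 1≤a a≤99 ax≡N
  where
  r x : ℕ
  r = repunit 100 (3 + t % 210)
  x = r % M
  x∈table : T (inResidueTable x)
  x∈table = All.lookup (all⁺ (λ i → inResidueTable (repunit 100 (3 + i) % M)) (upTo 210) residueTable-complete)
                       (∈-upTo⁺ (m%n<n t 210))
  x≡501 : x % 1600 ≡ 501
  x≡501 = trans (m∣n⇒o%n%m≡o%m 1600 M r 1600∣M) (repunit≥3-%1600 (t % 210))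
  ax≡N : (a * x) % M ≡ N n % M
  ax≡N = begin
    (a * x) % M                          ≡⟨ cong (λ k → (a * k) % M) (repunit-%-periodic 100 3 210 M M∣100³*repunit210 t) ⟨
    (a * (repunit 100 (3 + t) % M)) % M  ≡⟨ *-%-absorbʳ a (repunit 100 (3 + t)) M ⟩
    (a * repunit 100 (3 + t)) % M        ≡⟨ cong (_% M) N≡ ⟨
    N n % M                              ∎

N≢*repunit : ∀ n k a → 1 ≤ a → a ≤ 99 → N n ≢ a * repunit 100 (2 + k)
N≢*repunit n zero    a = N≢101* n a
N≢*repunit n (suc t) a = N≢*repunit≥3 n t a

mainTheorem9 : (n ℓ a : ℕ) → 2 ≤ ℓ → 1 ≤ a → a ≤ 99 →
    ¬ (N n ≡ a * ((100 ^ ℓ ∸ 1) / 99))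
mainTheorem9 n (suc (suc k)) a (s≤s (s≤s z≤n)) 1≤a a≤99 N≡ =
  N≢*repunit n k a 1≤a a≤99 (trans N≡ (cong (a *_) ([^∸1]/≡repunit 99 (2 + k))))
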